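{- Let $P$ be an $^*\!\mathcal{X}$-term. (1) If the outname $\alpha\in N(P)$, then there exists a unique term $Q\preccurlyeq P$ such that $\alpha$ is a principal name for $Q$. (2) If the inname $x\in N(P)$, then there exists a unique term $R\preccurlyeq P$ such that $x$ is a principal name for $R$.
   Context: Setting: the $^*\!\mathcal{X}$ calculus, a term language for the classical sequent calculus with explicit weakening and contraction. Names are innames ($x,y,\dots$) and outnames ($\alpha,\beta,\dots$). The (pure) terms are: the capsule $\langle x.\alpha\rangle$ (axiom); the exporter $\widehat{x}P\widehat{\beta}\cdot\alpha$ (right arrow introduction, binding $x,\beta$); the importer $P\widehat{\alpha}[x]\widehat{y}Q$ (left arrow introduction, binding $\alpha$ in $P$ and $y$ in $Q$); the cut $P\widehat{\alpha}\dagger\widehat{x}Q$ (binding $\alpha$ in $P$ and $x$ in $Q$); the left eraser $x\odot P$ and right eraser $P\odot\alpha$ (weakening); the left duplicator, which takes $P$ with free innames $x_1,x_2$, binds them and produces a single free inname $x$, and the right duplicator, which takes $P$ with free outnames $\alpha_1,\alpha_2$, binds them and produces a single free outname $\alpha$ (contraction). $N(P)$ is the set of free names of $P$. Only linear terms are considered: every name has at most one free occurrence, and every binder binds exactly one actual occurrence of a name. Contexts $C\{\ \}$ are built from the hole $\{\ \}$ by placing it in an immediate-subterm position of any of the constructors above (exporter body, either side of an importer or cut, the body of an eraser or duplicator), and by composition $C\{C\{\ \}\}$. $Q$ is a subterm of $P$, written $Q\preccurlyeq P$, iff $P=C\{Q\}$ for some context $C\{\ \}$; this relation is reflexive, antisymmetric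 and transitive. Principal names: the L-principal names are $x$ and $\alpha$ for $\langle x.\alpha\rangle$; $\alpha$ for $\widehat{x}P\widehat{\beta}\cdot\alpha$; $x$ for $P\widehat{\alpha}[x]\widehat{y}Q$; none for a cut. The S-principal names are $x$ for $x\odot P$; $\alpha$ for $P\odot\alpha$; the produced name $x$ for a left duplicator; the produced name $\alpha$ for a right duplicator. A name is principal for a term if it is L-principal or S-principal for it. -}

module Defs where

open import Data.Nat using (ℕ; _≟_)
open import Data.List using (List; []; _∷_; _++_)
open import Data.List.Membership.Propositional using (_∈_)
open import Data.List.Relation.Unary.Unique.Propositional using (Unique)
open import Data.Product using (Σ; _×_)
open import Data.Unit using (⊤)
open import Data.Bool using (if_then_else_)
open import Relation.Nullary using (does)
open import Relation.Binary.PropositionalEquality using (_≡_)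

-- Innames and outnames (two separate sorts; positions in the syntax keep them apart).
Inname : Set
Inname = ℕ

Outname : Set
Outname = ℕ

data Term : Set where
  cap    : Inname → Outname → Term
  -- x̂ P β̂ · α   (binds x, β in P)
  exp    : Inname → Term → Outname → Outname → Term
  -- P α̂ [x] ŷ Q   (binds α in P, y in Q)
  imp    : Term → Outname → Inname → Inname → Term → Term
  -- P α̂ † x̂ Q   (binds α in P, x in Q)
  cut    : Term → Outname → Inname → Term → Term
  lerase : Inname → Term → Term
  rerase : Term → Outname → Term
  -- left duplicator: ldup x₁ x₂ x P binds x₁ x₂ in P, produces x
  ldup   : Inname → Inname → Inname → Term → Term
  -- right duplicator: rdup α₁ α₂ α P binds α₁ α₂ in P, produces α
  rdup   : Outname → Outname → Outname → Term → Term

del : ℕ → List ℕ → List ℕ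
del x [] = []
del x (y ∷ ys) = if does (x ≟ y) then del x ys else (y ∷ del x ys)

-- free innames / free outnames  (N(P) is their union)
freeIn : Term → List Inname
freeIn (cap x α) = x ∷ []
freeIn (exp x P β α) = del x (freeIn P)
freeIn (imp P α x y Q) = freeIn P ++ (x ∷ del y (freeIn Q))
freeIn (cut P α x Q) = freeIn P ++ del x (freeIn Q)
freeIn (lerase x P) = x ∷ freeIn P
freeIn (rerase P α) = freeIn P
freeIn (ldup x₁ x₂ x P) = x ∷ del x₁ (del x₂ (freeIn P))
freeIn (rdup α₁ α₂ α P) = freeIn P

freeOut : Term → List Outname
freeOut (cap x α) = α ∷ []
freeOut (exp x P β α) = α ∷ del β (freeOut P)
freeOut (imp P α x y Q) = del α (freeOut P) ++ freeOut Q
freeOut (cut P α x Q) = del α (freeOut P) ++ freeOut Q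
freeOut (lerase x P) = freeOut P
freeOut (rerase P α) = α ∷ freeOut P
freeOut (ldup x₁ x₂ x P) = freeOut P
freeOut (rdup α₁ α₂ α P) = α ∷ del α₁ (del α₂ (freeOut P))

-- all actual (non-binder) occurrences of innames / outnames, free or bound
occIn : Term → List Inname
occIn (cap x α) = x ∷ []
occIn (exp x P β α) = occIn P
occIn (imp P α x y Q) = occIn P ++ (x ∷ occIn Q)
occIn (cut P α x Q) = occIn P ++ occIn Q
occIn (lerase x P) = x ∷ occIn P
occIn (rerase P α) = occIn P
occIn (ldup x₁ x₂ x P) = x ∷ occIn P
occIn (rdup α₁ α₂ α P) = occIn P

occOut : Term → List Outname
occOut (cap x α) = α ∷ []
occOut (exp x P β α) = α ∷ occOut P
occOut (imp P α x y Q) = occOut P ++ occOut Q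
occOut (cut P α x Q) = occOut P ++ occOut Q
occOut (lerase x P) = occOut P
occOut (rerase P α) = α ∷ occOut P
occOut (ldup x₁ x₂ x P) = occOut P
occOut (rdup α₁ α₂ α P) = α ∷ occOut P

BindersOK : Term → Set
BindersOK (cap x α) = ⊤
BindersOK (exp x P β α) = x ∈ freeIn P × β ∈ freeOut P × BindersOK P
BindersOK (imp P α x y Q) = α ∈ freeOut P × y ∈ freeIn Q × BindersOK P × BindersOK Q
BindersOK (cut P α x Q) = α ∈ freeOut P × x ∈ freeIn Q × BindersOK P × BindersOK Q
BindersOK (lerase x P) = BindersOK P
BindersOK (rerase P α) = BindersOK P
BindersOK (ldup x₁ x₂ x P) = x₁ ∈ freeIn P × x₂ ∈ freeIn P × BindersOK P
BindersOK (rdup α₁ α₂ α P) = α₁ ∈ freeOut P × α₂ ∈ freeOut P × BindersOK P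

-- Linearity (with the variable convention): every name has at most one actual
-- occurrence in the term, and every binder binds exactly one actual occurrence.
Linear : Term → Set
Linear P = Unique (occIn P) × Unique (occOut P) × BindersOK P

data Ctx : Set where
  hole    : Ctx
  expC    : Inname → Ctx → Outname → Outname → Ctx
  impL    : Ctx → Outname → Inname → Inname → Term → Ctx
  impR    : Term → Outname → Inname → Inname → Ctx → Ctx
  cutL    : Ctx → Outname → Inname → Term → Ctx
  cutR    : Term → Outname → Inname → Ctx → Ctx
  leraseC : Inname → Ctx → Ctx
  reraseC : Ctx → Outname → Ctx
  ldupC   : Inname → Inname → Inname → Ctx → Ctx
  rdupC   : Outname → Outname → Outname → Ctx → Ctx

plug : Ctx → Term → Term
plug hole Q = Q
plug (expC x C β α) Q = exp x (plug C Q) β α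
plug (impL C α x y R) Q = imp (plug C Q) α x y R
plug (impR P α x y C) Q = imp P α x y (plug C Q)
plug (cutL C α x R) Q = cut (plug C Q) α x R
plug (cutR P α x C) Q = cut P α x (plug C Q)
plug (leraseC x C) Q = lerase x (plug C Q)
plug (reraseC C α) Q = rerase (plug C Q) α
plug (ldupC x₁ x₂ x C) Q = ldup x₁ x₂ x (plug C Q)
plug (rdupC α₁ α₂ α C) Q = rdup α₁ α₂ α (plug C Q)

_≼_ : Term → Term → Set
Q ≼ P = Σ Ctx (λ C → plug C Q ≡ P)

data PrincipalIn : Inname → Term → Set where
  p-cap    : ∀ {x α} → PrincipalIn x (cap x α)
  p-imp    : ∀ {P α x y Q} → PrincipalIn x (imp P α x y Q)
  p-lerase : ∀ {x P} → PrincipalIn x (lerase x P)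
  p-ldup   : ∀ {x₁ x₂ x P} → PrincipalIn x (ldup x₁ x₂ x P)

data PrincipalOut : Outname → Term → Set where
  p-cap    : ∀ {x α} → PrincipalOut α (cap x α)
  p-exp    : ∀ {x P β α} → PrincipalOut α (exp x P β α)
  p-rerase : ∀ {P α} → PrincipalOut α (rerase P α)
  p-rdup   : ∀ {α₁ α₂ α P} → PrincipalOut α (rdup α₁ α₂ α P)

-- The argument is the same for innames and outnames, so it is carried out
-- once, for an abstract "name sort" (an occurrence list, a free-name list and
-- a principality predicate) satisfying a handful of local facts, each of
-- which only concerns a node and its immediate subterms:
--   * existence: a free name of a term is either principal for the term
--     itself or free in one of its immediate subterms; since the
--     immediate-subterm relation is well founded, descending along it ends
--     at a subterm for which the name is principal;
--   * uniqueness: if all occurrences in a term are distinct, a principal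
--     occurrence does not reappear inside an immediate subterm, and two
--     immediate subterms sharing an occurrence coincide; induction on two
--     subterm derivations then shows that two subterms with the same
--     principal name are equal.
module Submission where

open import Defs
open import Data.List.Membership.Propositional using (_∈_)
open import Data.Product using (_×_; ∃!)
open import Relation.Binary.PropositionalEquality using (_≡_)

open import Data.Nat using (ℕ; _≟_)
open import Data.List using (List; []; _∷_; _++_)
open import Data.List.Relation.Unary.Any using (here; there)
open import Data.List.Relation.Unary.All using (lookup)
open import Data.List.Relation.Unary.All.Properties using (++⁻ˡ)
open import Data.List.Relation.Unary.AllPairs as AllPairs using (_∷_)
open import Data.List.Relation.Unary.Unique.Propositional using (Unique)
open import Data.List.Relation.Unary.Unique.Propositional.Properties
  using (Unique[x∷xs]⇒x∉xs)
open import Data.List.Relation.Binary.Disjoint.Propositional using (Disjoint)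
open import Data.List.Membership.Propositional.Properties
  using (∈-++⁺ˡ; ∈-++⁺ʳ; ∈-++⁻)
open import Data.Product using (∃-syntax; _,_)
open import Data.Sum using (_⊎_; inj₁; inj₂)
open import Data.Empty using (⊥; ⊥-elim)
open import Data.Bool using (true; false)
open import Relation.Nullary using (does)
open import Relation.Binary.PropositionalEquality using (refl; sym)
open import Induction.WellFounded using (WellFounded; Acc; acc)

∈-del : ∀ {a} b xs → a ∈ del b xs → a ∈ xs
∈-del b [] ()
∈-del b (y ∷ ys) m with does (b ≟ y) | m
... | true  | m′       = there (∈-del b ys m′)
... | false | here eq  = here eq
... | false | there m′ = there (∈-del b ys m′)

unique-++ˡ : ∀ (xs : List ℕ) {ys} → Unique (xs ++ ys) → Unique xs
unique-++ˡ []       _          = AllPairs.[]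
unique-++ˡ (_ ∷ xs) (px ∷ pxs) = ++⁻ˡ xs px ∷ unique-++ˡ xs pxs

unique-++ʳ : ∀ (xs : List ℕ) {ys} → Unique (xs ++ ys) → Unique ys
unique-++ʳ []       u         = u
unique-++ʳ (_ ∷ xs) (_ ∷ pxs) = unique-++ʳ xs pxs

unique-++-disjoint : ∀ (xs : List ℕ) {ys} → Unique (xs ++ ys) → Disjoint xs ys
unique-++-disjoint (_ ∷ xs) (px ∷ _) (here refl , m) = lookup px (∈-++⁺ʳ xs m) refl
unique-++-disjoint (_ ∷ xs) (_ ∷ u)  (there m₁ , m₂) = unique-++-disjoint xs u (m₁ , m₂)

unique-tail : ∀ {a : ℕ} {xs} → Unique (a ∷ xs) → Unique xs
unique-tail (_ ∷ u) = u

data Child : Term → Term → Set where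
  exp-body    : ∀ {x P β α}      → Child P (exp x P β α)
  imp-left    : ∀ {P α x y R}    → Child P (imp P α x y R)
  imp-right   : ∀ {P α x y R}    → Child R (imp P α x y R)
  cut-left    : ∀ {P α x R}      → Child P (cut P α x R)
  cut-right   : ∀ {P α x R}      → Child R (cut P α x R)
  lerase-body : ∀ {x P}          → Child P (lerase x P)
  rerase-body : ∀ {P α}          → Child P (rerase P α)
  ldup-body   : ∀ {x₁ x₂ x P}    → Child P (ldup x₁ x₂ x P)
  rdup-body   : ∀ {α₁ α₂ α P}    → Child P (rdup α₁ α₂ α P)

child-wellFounded : WellFounded Child
child-wellFounded P = acc (children-accessible P)
  where
  children-accessible : ∀ P {C} → Child C P → Acc Child C
  children-accessible (exp _ P _ _)    exp-body    = acc (children-accessible P)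
  children-accessible (imp P _ _ _ _)  imp-left    = acc (children-accessible P)
  children-accessible (imp _ _ _ _ R)  imp-right   = acc (children-accessible R)
  children-accessible (cut P _ _ _)    cut-left    = acc (children-accessible P)
  children-accessible (cut _ _ _ R)    cut-right   = acc (children-accessible R)
  children-accessible (lerase _ P)     lerase-body = acc (children-accessible P)
  children-accessible (rerase P _)     rerase-body = acc (children-accessible P)
  children-accessible (ldup _ _ _ P)   ldup-body   = acc (children-accessible P)
  children-accessible (rdup _ _ _ P)   rdup-body   = acc (children-accessible P)

data Subterm (Q : Term) : Term → Set where
  here : Subterm Q Q
  step : ∀ {C P} → Child C P → Subterm Q C → Subterm Q P

wrap : ∀ {C P} → Child C P → Ctx → Ctx
wrap (exp-body {x} {_} {β} {α})      K = expC x K β α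
wrap (imp-left {_} {α} {x} {y} {R})  K = impL K α x y R
wrap (imp-right {P} {α} {x} {y})     K = impR P α x y K
wrap (cut-left {_} {α} {x} {R})      K = cutL K α x R
wrap (cut-right {P} {α} {x})         K = cutR P α x K
wrap (lerase-body {x})               K = leraseC x K
wrap (rerase-body {_} {α})           K = reraseC K α
wrap (ldup-body {x₁} {x₂} {x})       K = ldupC x₁ x₂ x K
wrap (rdup-body {α₁} {α₂} {α})       K = rdupC α₁ α₂ α K

plug-wrap : ∀ {C P Q} (c : Child C P) (K : Ctx) → plug K Q ≡ C → plug (wrap c K) Q ≡ P
plug-wrap exp-body    K refl = refl
plug-wrap imp-left    K refl = refl
plug-wrap imp-right   K refl = refl
plug-wrap cut-left    K refl = refl
plug-wrap cut-right   K refl = refl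
plug-wrap lerase-body K refl = refl
plug-wrap rerase-body K refl = refl
plug-wrap ldup-body   K refl = refl
plug-wrap rdup-body   K refl = refl

subterm⇒≼ : ∀ {Q P} → Subterm Q P → Q ≼ P
subterm⇒≼ here = hole , refl
subterm⇒≼ (step c s) with subterm⇒≼ s
... | K , eq = wrap c K , plug-wrap c K eq

plug-subterm : ∀ {Q} (K : Ctx) → Subterm Q (plug K Q)
plug-subterm hole                = here
plug-subterm (expC _ K _ _)      = step exp-body    (plug-subterm K)
plug-subterm (impL K _ _ _ _)    = step imp-left    (plug-subterm K)
plug-subterm (impR _ _ _ _ K)    = step imp-right   (plug-subterm K)
plug-subterm (cutL K _ _ _)      = step cut-left    (plug-subterm K)
plug-subterm (cutR _ _ _ K)      = step cut-right   (plug-subterm K)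
plug-subterm (leraseC _ K)       = step lerase-body (plug-subterm K)
plug-subterm (reraseC K _)       = step rerase-body (plug-subterm K)
plug-subterm (ldupC _ _ _ K)     = step ldup-body   (plug-subterm K)
plug-subterm (rdupC _ _ _ K)     = step rdup-body   (plug-subterm K)

≼⇒subterm : ∀ {Q P} → Q ≼ P → Subterm Q P
≼⇒subterm (K , refl) = plug-subterm K

record NameSort : Set₁ where
  field
    occ       : Term → List ℕ
    free      : Term → List ℕ
    Principal : ℕ → Term → Set
    principal-occurs  : ∀ {a P} → Principal a P → a ∈ occ P
    child-occ         : ∀ {a C P} → Child C P → a ∈ occ C → a ∈ occ P
    child-unique      : ∀ {C P} → Child C P → Unique (occ P) → Unique (occ C)
    children-disjoint : ∀ {a C₁ C₂ P} → Unique (occ P) → Child C₁ P → Child C₂ P →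
                        a ∈ occ C₁ → a ∈ occ C₂ → C₁ ≡ C₂
    principal-private : ∀ {a C P} → Unique (occ P) → Principal a P → Child C P →
                        a ∈ occ C → ⊥
    free-located      : ∀ {a P} → a ∈ free P →
                        Principal a P ⊎ ∃[ C ] (Child C P × a ∈ free C)

module PrincipalSubterm (S : NameSort) where
  open NameSort S

  subterm-occ : ∀ {a Q P} → Subterm Q P → a ∈ occ Q → a ∈ occ P
  subterm-occ here       m = m
  subterm-occ (step c s) m = child-occ c (subterm-occ s m)

  principal-exists : ∀ {a P} → Acc Child P → a ∈ free P →
                     ∃[ Q ] (Subterm Q P × Principal a Q)
  principal-exists (acc rs) m with free-located m
  ... | inj₁ p            = _ , here , p
  ... | inj₂ (C , c , m′) with principal-exists (rs c) m′
  ...   | Q , s , p = Q , step c s , p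

  principal-outermost : ∀ {a Q P} → Unique (occ P) → Principal a P →
                        Subterm Q P → Principal a Q → Q ≡ P
  principal-outermost u p here       q = refl
  principal-outermost u p (step c s) q =
    ⊥-elim (principal-private u p c (subterm-occ s (principal-occurs q)))

  principal-unique : ∀ {a Q₁ Q₂ P} → Unique (occ P) → Subterm Q₁ P → Subterm Q₂ P →
                     Principal a Q₁ → Principal a Q₂ → Q₁ ≡ Q₂
  principal-unique u here s₂ p₁ p₂ = sym (principal-outermost u p₁ s₂ p₂)
  principal-unique u s₁ here p₁ p₂ = principal-outermost u p₂ s₁ p₁
  principal-unique u (step c₁ s₁) (step c₂ s₂) p₁ p₂
    with children-disjoint u c₁ c₂ (subterm-occ s₁ (principal-occurs p₁))
                                   (subterm-occ s₂ (principal-occurs p₂))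
  ... | refl = principal-unique (child-unique c₁ u) s₁ s₂ p₁ p₂

  principal-subterm : ∀ {P} → Unique (occ P) → (a : ℕ) → a ∈ free P →
                      ∃! _≡_ (λ Q → Q ≼ P × Principal a Q)
  principal-subterm {P} u a m with principal-exists (child-wellFounded P) m
  ... | Q , s , p = Q , (subterm⇒≼ s , p) ,
                    λ (le , p′) → principal-unique u s (≼⇒subterm le) p p′

outnames : NameSort
outnames = record
  { occ = occOut ; free = freeOut ; Principal = PrincipalOut
  ; principal-occurs = principal-occurs ; child-occ = child-occ ; child-unique = child-unique
  ; children-disjoint = children-disjoint ; principal-private = principal-private
  ; free-located = free-located }
  where
  principal-occurs : ∀ {a P} → PrincipalOut a P → a ∈ occOut P
  principal-occurs p-cap    = here refl
  principal-occurs p-exp    = here refl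
  principal-occurs p-rerase = here refl
  principal-occurs p-rdup   = here refl

  child-occ : ∀ {a C P} → Child C P → a ∈ occOut C → a ∈ occOut P
  child-occ exp-body              m = there m
  child-occ imp-left              m = ∈-++⁺ˡ m
  child-occ (imp-right {P})       m = ∈-++⁺ʳ (occOut P) m
  child-occ cut-left              m = ∈-++⁺ˡ m
  child-occ (cut-right {P})       m = ∈-++⁺ʳ (occOut P) m
  child-occ lerase-body           m = m
  child-occ rerase-body           m = there m
  child-occ ldup-body             m = m
  child-occ rdup-body             m = there m

  child-unique : ∀ {C P} → Child C P → Unique (occOut P) → Unique (occOut C)
  child-unique exp-body          u = unique-tail u
  child-unique (imp-left {P})    u = unique-++ˡ (occOut P) u
  child-unique (imp-right {P})   u = unique-++ʳ (occOut P) u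
  child-unique (cut-left {P})    u = unique-++ˡ (occOut P) u
  child-unique (cut-right {P})   u = unique-++ʳ (occOut P) u
  child-unique lerase-body       u = u
  child-unique rerase-body       u = unique-tail u
  child-unique ldup-body         u = u
  child-unique rdup-body         u = unique-tail u

  children-disjoint : ∀ {a C₁ C₂ P} → Unique (occOut P) → Child C₁ P → Child C₂ P →
                      a ∈ occOut C₁ → a ∈ occOut C₂ → C₁ ≡ C₂
  children-disjoint u (imp-left {P}) imp-right m₁ m₂ =
    ⊥-elim (unique-++-disjoint (occOut P) u (m₁ , m₂))
  children-disjoint u (imp-right {P}) imp-left m₁ m₂ =
    ⊥-elim (unique-++-disjoint (occOut P) u (m₂ , m₁))
  children-disjoint u (cut-left {P}) cut-right m₁ m₂ =
    ⊥-elim (unique-++-disjoint (occOut P) u (m₁ , m₂))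
  children-disjoint u (cut-right {P}) cut-left m₁ m₂ =
    ⊥-elim (unique-++-disjoint (occOut P) u (m₂ , m₁))
  children-disjoint u exp-body    exp-body    _ _ = refl
  children-disjoint u imp-left    imp-left    _ _ = refl
  children-disjoint u imp-right   imp-right   _ _ = refl
  children-disjoint u cut-left    cut-left    _ _ = refl
  children-disjoint u cut-right   cut-right   _ _ = refl
  children-disjoint u lerase-body lerase-body _ _ = refl
  children-disjoint u rerase-body rerase-body _ _ = refl
  children-disjoint u ldup-body   ldup-body   _ _ = refl
  children-disjoint u rdup-body   rdup-body   _ _ = refl

  principal-private : ∀ {a C P} → Unique (occOut P) → PrincipalOut a P → Child C P →
             a ∈ occOut C → ⊥
  principal-private u p-exp    exp-body    m = Unique[x∷xs]⇒x∉xs u m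
  principal-private u p-rerase rerase-body m = Unique[x∷xs]⇒x∉xs u m
  principal-private u p-rdup   rdup-body   m = Unique[x∷xs]⇒x∉xs u m

  free-located : ∀ {a P} → a ∈ freeOut P →
            PrincipalOut a P ⊎ ∃[ C ] (Child C P × a ∈ freeOut C)
  free-located {P = cap _ _} (here refl) = inj₁ p-cap
  free-located {P = exp _ _ _ _} (here refl) = inj₁ p-exp
  free-located {P = exp _ P β _} (there m) = inj₂ (P , exp-body , ∈-del β _ m)
  free-located {P = imp P α _ _ R} m with ∈-++⁻ (del α (freeOut P)) m
  ... | inj₁ m′ = inj₂ (P , imp-left , ∈-del α _ m′)
  ... | inj₂ m′ = inj₂ (R , imp-right , m′)
  free-located {P = cut P α _ R} m with ∈-++⁻ (del α (freeOut P)) m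
  ... | inj₁ m′ = inj₂ (P , cut-left , ∈-del α _ m′)
  ... | inj₂ m′ = inj₂ (R , cut-right , m′)
  free-located {P = lerase _ P} m = inj₂ (P , lerase-body , m)
  free-located {P = rerase _ _} (here refl) = inj₁ p-rerase
  free-located {P = rerase P _} (there m) = inj₂ (P , rerase-body , m)
  free-located {P = ldup _ _ _ P} m = inj₂ (P , ldup-body , m)
  free-located {P = rdup _ _ _ _} (here refl) = inj₁ p-rdup
  free-located {P = rdup α₁ α₂ _ P} (there m) =
    inj₂ (P , rdup-body , ∈-del α₂ _ (∈-del α₁ _ m))

-- Innames: occurrences are read off occIn, principal names per PrincipalIn.
-- The importer's principal inname sits between the occurrences of its two sides.
innames : NameSort
innames = record
  { occ = occIn ; free = freeIn ; Principal = PrincipalIn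
  ; principal-occurs = principal-occurs ; child-occ = child-occ ; child-unique = child-unique
  ; children-disjoint = children-disjoint ; principal-private = principal-private
  ; free-located = free-located }
  where
  principal-occurs : ∀ {a P} → PrincipalIn a P → a ∈ occIn P
  principal-occurs p-cap         = here refl
  principal-occurs (p-imp {P})   = ∈-++⁺ʳ (occIn P) (here refl)
  principal-occurs p-lerase      = here refl
  principal-occurs p-ldup        = here refl

  child-occ : ∀ {a C P} → Child C P → a ∈ occIn C → a ∈ occIn P
  child-occ exp-body              m = m
  child-occ imp-left              m = ∈-++⁺ˡ m
  child-occ (imp-right {P})       m = ∈-++⁺ʳ (occIn P) (there m)
  child-occ cut-left              m = ∈-++⁺ˡ m
  child-occ (cut-right {P})       m = ∈-++⁺ʳ (occIn P) m
  child-occ lerase-body           m = there m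
  child-occ rerase-body           m = m
  child-occ ldup-body             m = there m
  child-occ rdup-body             m = m

  child-unique : ∀ {C P} → Child C P → Unique (occIn P) → Unique (occIn C)
  child-unique exp-body          u = u
  child-unique (imp-left {P})    u = unique-++ˡ (occIn P) u
  child-unique (imp-right {P})   u = unique-tail (unique-++ʳ (occIn P) u)
  child-unique (cut-left {P})    u = unique-++ˡ (occIn P) u
  child-unique (cut-right {P})   u = unique-++ʳ (occIn P) u
  child-unique lerase-body       u = unique-tail u
  child-unique rerase-body       u = u
  child-unique ldup-body         u = unique-tail u
  child-unique rdup-body         u = u

  children-disjoint : ∀ {a C₁ C₂ P} → Unique (occIn P) → Child C₁ P → Child C₂ P →
                      a ∈ occIn C₁ → a ∈ occIn C₂ → C₁ ≡ C₂
  children-disjoint u (imp-left {P}) imp-right m₁ m₂ =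
    ⊥-elim (unique-++-disjoint (occIn P) u (m₁ , there m₂))
  children-disjoint u (imp-right {P}) imp-left m₁ m₂ =
    ⊥-elim (unique-++-disjoint (occIn P) u (m₂ , there m₁))
  children-disjoint u (cut-left {P}) cut-right m₁ m₂ =
    ⊥-elim (unique-++-disjoint (occIn P) u (m₁ , m₂))
  children-disjoint u (cut-right {P}) cut-left m₁ m₂ =
    ⊥-elim (unique-++-disjoint (occIn P) u (m₂ , m₁))
  children-disjoint u exp-body    exp-body    _ _ = refl
  children-disjoint u imp-left    imp-left    _ _ = refl
  children-disjoint u imp-right   imp-right   _ _ = refl
  children-disjoint u cut-left    cut-left    _ _ = refl
  children-disjoint u cut-right   cut-right   _ _ = refl
  children-disjoint u lerase-body lerase-body _ _ = refl
  children-disjoint u rerase-body rerase-body _ _ = refl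
  children-disjoint u ldup-body   ldup-body   _ _ = refl
  children-disjoint u rdup-body   rdup-body   _ _ = refl

  principal-private : ∀ {a C P} → Unique (occIn P) → PrincipalIn a P → Child C P →
             a ∈ occIn C → ⊥
  principal-private u (p-imp {P}) imp-left  m = unique-++-disjoint (occIn P) u (m , here refl)
  principal-private u (p-imp {P}) imp-right m = Unique[x∷xs]⇒x∉xs (unique-++ʳ (occIn P) u) m
  principal-private u p-lerase    lerase-body m = Unique[x∷xs]⇒x∉xs u m
  principal-private u p-ldup      ldup-body   m = Unique[x∷xs]⇒x∉xs u m

  free-located : ∀ {a P} → a ∈ freeIn P →
            PrincipalIn a P ⊎ ∃[ C ] (Child C P × a ∈ freeIn C)
  free-located {P = cap _ _} (here refl) = inj₁ p-cap
  free-located {P = exp x P _ _} m = inj₂ (P , exp-body , ∈-del x _ m)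
  free-located {P = imp P _ _ y R} m with ∈-++⁻ (freeIn P) m
  ... | inj₁ m′         = inj₂ (P , imp-left , m′)
  ... | inj₂ (here refl) = inj₁ p-imp
  ... | inj₂ (there m′) = inj₂ (R , imp-right , ∈-del y _ m′)
  free-located {P = cut P _ x R} m with ∈-++⁻ (freeIn P) m
  ... | inj₁ m′ = inj₂ (P , cut-left , m′)
  ... | inj₂ m′ = inj₂ (R , cut-right , ∈-del x _ m′)
  free-located {P = lerase _ _} (here refl) = inj₁ p-lerase
  free-located {P = lerase _ P} (there m) = inj₂ (P , lerase-body , m)
  free-located {P = rerase P _} m = inj₂ (P , rerase-body , m)
  free-located {P = ldup _ _ _ _} (here refl) = inj₁ p-ldup
  free-located {P = ldup x₁ x₂ _ P} (there m) =
    inj₂ (P , ldup-body , ∈-del x₂ _ (∈-del x₁ _ m))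
  free-located {P = rdup _ _ _ P} m = inj₂ (P , rdup-body , m)

-- Linearity makes the occurrences of each sort distinct, so both parts follow.
lemma3 : (P : Term) → Linear P →
    ((α : Outname) → α ∈ freeOut P → ∃! _≡_ (λ Q → Q ≼ P × PrincipalOut α Q))
    × ((x : Inname) → x ∈ freeIn P → ∃! _≡_ (λ R → R ≼ P × PrincipalIn x R))
lemma3 P (distinct-innames , distinct-outnames , _) =
  PrincipalSubterm.principal-subterm outnames distinct-outnames ,
  PrincipalSubterm.principal-subterm innames distinct-innames
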